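{- Let $G$ be a graph with girth $g\ge 3$. If $g$ is odd then $mag^+(G)\ge g-1$, and if $g$ is even then $mag^+(G)\ge g$.
   Context: The girth is the length of a shortest cycle. For an oriented graph $\vec G$, two distinct vertices $x,y$ monitor an arc $a$ if $a$ lies on every shortest directed path from $x$ to $y$, or on every shortest directed path from $y$ to $x$. A monitoring arc-geodetic set (MAG-set) is a vertex set $M$ such that every arc is monitored by some pair of distinct vertices of $M$; $mag(\vec G)$ is its minimum size. $mag^+(G)$ is the maximum of $mag(\vec G)$ over all orientations $\vec G$ of $G$. Graphs are assumed connected. -}

module Defs where

open import Level using (0ℓ)
open import Data.Nat using (ℕ; zero; suc; _≤_; _<_; _*_)
open import Data.Fin using (Fin; zero; suc; toℕ; inject₁; fromℕ)
open import Function.Definitions using (Injective)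
open import Data.Fin.Subset using (Subset; _∈_; ∣_∣)
open import Data.Fin.Properties using ()
open import Data.Product using (Σ; ∃; _×_; _,_)
open import Data.Sum using (_⊎_)
open import Data.Empty using (⊥)
open import Relation.Nullary using (¬_)
open import Relation.Binary.PropositionalEquality using (_≡_; _≢_)

Even : ℕ → Set
Even g = ∃ λ k → g ≡ 2 * k

Odd : ℕ → Set
Odd g = ∃ λ k → g ≡ suc (2 * k)

record Graph (n : ℕ) : Set₁ where
  field
    Adj     : Fin n → Fin n → Set
    sym     : ∀ {u v} → Adj u v → Adj v u
    irrefl  : ∀ {u} → ¬ Adj u u

open Graph public

data Walk {n : ℕ} (G : Graph n) : Fin n → Fin n → ℕ → Set where
  []  : ∀ {x} → Walk G x x 0
  _∷_ : ∀ {x y z ℓ} → Adj G x y → Walk G y z ℓ → Walk G x z (suc ℓ)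

Connected : ∀ {n} → Graph n → Set
Connected {n} G = (x y : Fin n) → ∃ λ ℓ → Walk G x y ℓ

record Cycle {n : ℕ} (G : Graph n) (k : ℕ) : Set where
  field
    m       : ℕ
    len     : k ≡ suc m
    atLeast3 : 3 ≤ k
    vtx     : Fin (suc m) → Fin n
    inj     : Injective _≡_ _≡_ vtx
    step    : (i : Fin m) → Adj G (vtx (inject₁ i)) (vtx (suc i))
    close   : Adj G (vtx (fromℕ m)) (vtx zero)

Girth : ∀ {n} → Graph n → ℕ → Set
Girth G g = Cycle G g × (∀ k → Cycle G k → g ≤ k)

record Orientation {n : ℕ} (G : Graph n) : Set₁ where
  field
    Arc      : Fin n → Fin n → Set
    arc⇒adj  : ∀ {u v} → Arc u v → Adj G u v
    adj⇒arc  : ∀ {u v} → Adj G u v → Arc u v ⊎ Arc v u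
    antisym  : ∀ {u v} → Arc u v → ¬ Arc v u

open Orientation public

data DWalk {n : ℕ} {G : Graph n} (O : Orientation G) : Fin n → Fin n → ℕ → Set where
  []  : ∀ {x} → DWalk O x x 0
  _∷_ : ∀ {x y z ℓ} → Arc O x y → DWalk O y z ℓ → DWalk O x z (suc ℓ)

data UsesArc {n : ℕ} {G : Graph n} {O : Orientation G} (u v : Fin n)
     : ∀ {x z ℓ} → DWalk O x z ℓ → Set where
  here  : ∀ {z ℓ} {a : Arc O u v} {w : DWalk O v z ℓ} → UsesArc u v (a ∷ w)
  there : ∀ {x y z ℓ} {a : Arc O x y} {w : DWalk O y z ℓ} →
          UsesArc u v w → UsesArc u v (a ∷ w)

IsShortest : ∀ {n} {G : Graph n} {O : Orientation G} {x y ℓ} → DWalk O x y ℓ → Set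
IsShortest {O = O} {x} {y} {ℓ} w = ∀ m → DWalk O x y m → ℓ ≤ m

OnAllShortest : ∀ {n} {G : Graph n} (O : Orientation G) (x y u v : Fin n) → Set
OnAllShortest O x y u v =
  (∃ λ ℓ → DWalk O x y ℓ) ×
  (∀ ℓ (w : DWalk O x y ℓ) → IsShortest w → UsesArc u v w)

Monitors : ∀ {n} {G : Graph n} (O : Orientation G) (x y u v : Fin n) → Set
Monitors O x y u v = x ≢ y × (OnAllShortest O x y u v ⊎ OnAllShortest O y x u v)

IsMAG : ∀ {n} {G : Graph n} (O : Orientation G) → Subset n → Set
IsMAG {n} O M = ∀ u v → Arc O u v →
  Σ (Fin n) λ x → Σ (Fin n) λ y → x ∈ M × y ∈ M × Monitors O x y u v

MagAtLeast : ∀ {n} {G : Graph n} → Orientation G → ℕ → Set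
MagAtLeast O k = ∀ M → IsMAG O M → k ≤ ∣ M ∣

MagPlusAtLeast : ∀ {n} → Graph n → ℕ → Set₁
MagPlusAtLeast G k = Σ (Orientation G) λ O → MagAtLeast O k

{-# OPTIONS --safe #-}

-- Let c₀ … c_{g-1} be a shortest cycle and K = ⌊g/2⌋. A chord between cᵢ and cⱼ with
-- i < j < 2K and j - i even would close an odd cycle of length j - i + 1 < g, so the
-- even-indexed and the odd-indexed vertices among c₀ … c_{2K-1} form two independent
-- sets. Put the even ones on the lowest level, the odd ones on the highest and all
-- other vertices in between, and orient every edge upwards (ties broken by vertex
-- number). Then each even cᵢ is a source and each odd cᵢ a sink, and each is incident
-- to an edge of the cycle. A source (sink) is the first (last) vertex of every directed
-- walk through any of its arcs, so it belongs to every pair monitoring such an arc.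
-- Hence every MAG-set contains all of c₀ … c_{2K-1}, and 2K is g - 1 or g.
module Submission where

open import Defs
open import Data.Nat using (ℕ; zero; suc; _+_; _*_; _∸_; _≤_; _<_; s≤s; z≤n; _≤?_)
open import Data.Nat.Properties
  using (≤-refl; ≤-trans; ≤-pred; <-≤-trans; ≤-<-trans; n≤1+n; m≤n+m; ≰⇒>; <⇒≱; <-cmp; <-asym;
         +-suc; +-identityʳ; +-monoʳ-≤; +-cancelˡ-≡; *-suc; *-monoʳ-≤; *-monoʳ-<; *-cancelˡ-<;
         *-distribˡ-+; m≤n⇒∃[o]m+o≡n; even≢odd; anyUpTo?)
open import Data.Nat.DivMod using (_mod_; m≤n⇒m%n≡m)
open import Data.Nat.Induction using (<-wellFounded)
open import Data.Fin as Fin using (Fin; toℕ; inject₁; fromℕ; fromℕ<; combine)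
open import Data.Fin.Patterns using (0F; 1F; 2F)
open import Data.Fin.Properties
  using (toℕ-injective; toℕ-fromℕ<; toℕ-inject₁; toℕ-fromℕ; toℕ<n; toℕ≤pred[n]; 0≢1+n;
         combine-injectiveʳ; combine-monoˡ-<)
  renaming (suc-injective to Fin-suc-injective)
open import Data.Fin.Subset using (Subset; _∈_; _-_; ∣_∣)
open import Data.Fin.Subset.Properties using (_∈?_; x∈p∧x≢y⇒x∈p-y; x∈p⇒∣p-x∣<∣p∣)
open import Data.Product using (Σ; ∃; ∃₂; _×_; _,_)
open import Data.Sum using (_⊎_; inj₁; inj₂; [_,_]′)
open import Function using (_∘_)
open import Function.Definitions using (Injective)
open import Induction.WellFounded using (Acc; acc)
open import Level using (0ℓ)
open import Relation.Binary using (tri<; tri≈; tri>)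
open import Relation.Binary.PropositionalEquality
  using (_≡_; refl; trans; cong; subst; subst₂; module ≡-Reasoning)
  renaming (sym to ≡-sym)
open import Relation.Nullary using (¬_; yes; no; contradiction)
open import Relation.Nullary.Decidable using (decidable-stable)
open import Relation.Nullary.Negation using (¬¬-map)
open import Relation.Unary using (Pred; Decidable)

injection⇒≤∣p∣ : ∀ {k n} {p : Subset n} (f : Fin k → Fin n) → Injective _≡_ _≡_ f →
                 (∀ i → f i ∈ p) → k ≤ ∣ p ∣
injection⇒≤∣p∣ {zero} f _ _ = z≤n
injection⇒≤∣p∣ {suc k} f f-inj f∈p =
  ≤-<-trans (injection⇒≤∣p∣ (f ∘ Fin.suc) (Fin-suc-injective ∘ f-inj) f∘suc∈p-f0)
            (x∈p⇒∣p-x∣<∣p∣ (f∈p 0F))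
  where
  f∘suc∈p-f0 : ∀ i → f (Fin.suc i) ∈ _ - f 0F
  f∘suc∈p-f0 i = x∈p∧x≢y⇒x∈p-y (f∈p (Fin.suc i)) (0≢1+n ∘ ≡-sym ∘ f-inj)

module _ {n} {G : Graph n} (O : Orientation G) where

  Source Sink : Fin n → Set
  Source u = ∀ p → ¬ Arc O p u
  Sink   v = ∀ p → ¬ Arc O v p

  ShortestWalk : Fin n → Fin n → Set
  ShortestWalk x y = ∃₂ λ ℓ (w : DWalk O x y ℓ) → IsShortest w

  -- Arcs are not decidable, so a shortest walk exists only under double negation;
  -- this suffices below because membership in a subset is decidable.
  ¬¬shortestWalk : ∀ {x y ℓ} → Acc _<_ ℓ → DWalk O x y ℓ → ¬ ¬ ShortestWalk x y
  ¬¬shortestWalk {ℓ = ℓ} (acc shorter) w none = none (ℓ , w , shortest)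
    where
    shortest : IsShortest w
    shortest k w′ = decidable-stable (ℓ ≤? k)
      (λ ℓ≰k → ¬¬shortestWalk (shorter (≰⇒> ℓ≰k)) w′ none)

  onAllShortest⇒¬¬usesArc : ∀ {x y u v} → OnAllShortest O x y u v →
                            ¬ ¬ ∃₂ λ ℓ (w : DWalk O x y ℓ) → UsesArc u v w
  onAllShortest⇒¬¬usesArc ((ℓ , w) , onAll) =
    ¬¬-map (λ (ℓ′ , w′ , shortest) → ℓ′ , w′ , onAll ℓ′ w′ shortest)
           (¬¬shortestWalk (<-wellFounded ℓ) w)

  usesArc-source : ∀ {u v x z ℓ} {w : DWalk O x z ℓ} → Source u → UsesArc u v w → x ≡ u
  usesArc-source src here = refl
  usesArc-source src (there {a = a} uses) with refl ← usesArc-source src uses = contradiction a (src _)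

  usesArc-sink : ∀ {u v x z ℓ} {w : DWalk O x z ℓ} → Sink v → UsesArc u v w → z ≡ v
  usesArc-sink snk (here {w = []})    = refl
  usesArc-sink snk (here {w = a ∷ _}) = contradiction a (snk _)
  usesArc-sink snk (there uses)       = usesArc-sink snk uses

  source-arc : ∀ {u v} → Source u → Adj G u v → Arc O u v
  source-arc {v = v} src adj with adj⇒arc O adj
  ... | inj₁ uv = uv
  ... | inj₂ vu = contradiction vu (src v)

  sink-arc : ∀ {u v} → Sink v → Adj G u v → Arc O u v
  sink-arc {u} snk adj with adj⇒arc O adj
  ... | inj₁ uv = uv
  ... | inj₂ vu = contradiction vu (snk u)

  endpoint∈MAG : ∀ {M u v e} → IsMAG O M → Arc O u v →
                 (∀ {x z ℓ} {w : DWalk O x z ℓ} → UsesArc u v w → x ≡ e ⊎ z ≡ e) → e ∈ M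
  endpoint∈MAG {M} {u} {v} {e} mag uv endpoint = decidable-stable (e ∈? M) (monitored (mag u v uv))
    where
    ends∈M : ∀ {x z} → x ∈ M → z ∈ M → OnAllShortest O x z u v → ¬ ¬ e ∈ M
    ends∈M x∈M z∈M onAll = ¬¬-map
      (λ (_ , _ , uses) → [ (λ x≡e → subst (_∈ M) x≡e x∈M) , (λ z≡e → subst (_∈ M) z≡e z∈M) ]′
                            (endpoint uses))
      (onAllShortest⇒¬¬usesArc onAll)
    monitored : (Σ (Fin n) λ x → Σ (Fin n) λ y → x ∈ M × y ∈ M × Monitors O x y u v) →
                ¬ ¬ e ∈ M
    monitored (_ , _ , x∈M , y∈M , _ , inj₁ xy) = ends∈M x∈M y∈M xy
    monitored (_ , _ , x∈M , y∈M , _ , inj₂ yx) = ends∈M y∈M x∈M yx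

  source∈MAG : ∀ {M u v} → IsMAG O M → Source u → Adj G u v → u ∈ M
  source∈MAG mag src adj = endpoint∈MAG mag (source-arc src adj) (inj₁ ∘ usesArc-source src)

  sink∈MAG : ∀ {M u v} → IsMAG O M → Sink v → Adj G u v → v ∈ M
  sink∈MAG mag snk adj = endpoint∈MAG mag (sink-arc snk adj) (inj₂ ∘ usesArc-sink snk)

module OrientBy {n} (G : Graph n) (key : Fin n → ℕ) (key-inj : Injective _≡_ _≡_ key) where

  orientation : Orientation G
  orientation = record
    { Arc     = λ u v → Adj G u v × key u < key v
    ; arc⇒adj = λ (adj , _) → adj
    ; adj⇒arc = adj⇒arc′
    ; antisym = λ (_ , u<v) (_ , v<u) → <-asym u<v v<u
    }
    where
    adj⇒arc′ : ∀ {u v} → Adj G u v → (Adj G u v × key u < key v) ⊎ (Adj G v u × key v < key u)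
    adj⇒arc′ {u} {v} adj with <-cmp (key u) (key v)
    ... | tri< u<v _ _ = inj₁ (adj , u<v)
    ... | tri≈ _ u≡v _ = contradiction (subst (Adj G u) (≡-sym (key-inj u≡v)) adj) (irrefl G)
    ... | tri> _ _ v<u = inj₂ (Graph.sym G adj , v<u)

  source : ∀ {u} → (∀ {p} → Adj G p u → key u < key p) → Source orientation u
  source below p (adj , p<u) = <-asym p<u (below adj)

  sink : ∀ {v} → (∀ {p} → Adj G v p → key p < key v) → Sink orientation v
  sink above p (adj , v<p) = <-asym v<p (above adj)

Independent : ∀ {n} → Graph n → Pred (Fin n) 0ℓ → Set
Independent G S = ∀ {u v} → S u → S v → ¬ Adj G u v

module Layered {n} (G : Graph n) {S T : Pred (Fin n) 0ℓ} (S? : Decidable S) (T? : Decidable T)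
               (S-independent : Independent G S) (T-independent : Independent G T)
               (S∩T≡∅ : ∀ {v} → S v → ¬ T v) where

  level : Fin n → Fin 3
  level v with S? v | T? v
  ... | yes _ | _     = 0F
  ... | no _  | yes _ = 2F
  ... | no _  | no _  = 1F

  level-S : ∀ {v} → S v → level v ≡ 0F
  level-S {v} s with S? v | T? v
  ... | yes _ | _ = refl
  ... | no ¬s | _ = contradiction s ¬s

  level-T : ∀ {v} → T v → level v ≡ 2F
  level-T {v} t with S? v | T? v
  ... | yes s | _     = contradiction t (S∩T≡∅ s)
  ... | no _  | yes _ = refl
  ... | no _  | no ¬t = contradiction t ¬t

  level-∉S : ∀ {v} → ¬ S v → 0 < toℕ (level v)
  level-∉S {v} ¬s with S? v | T? v
  ... | yes s | _     = contradiction s ¬s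
  ... | no _  | yes _ = s≤s z≤n
  ... | no _  | no _  = s≤s z≤n

  level-∉T : ∀ {v} → ¬ T v → toℕ (level v) < 2
  level-∉T {v} ¬t with S? v | T? v
  ... | yes _ | _     = s≤s z≤n
  ... | no _  | yes t = contradiction t ¬t
  ... | no _  | no _  = s≤s (s≤s z≤n)

  key : Fin n → ℕ
  key v = toℕ (combine (level v) v)

  key-injective : Injective _≡_ _≡_ key
  key-injective {u} {v} e = combine-injectiveʳ (level u) u (level v) v (toℕ-injective e)

  open OrientBy G key key-injective public using (orientation)

  source : ∀ {u} → S u → Source orientation u
  source {u} s = OrientBy.source G key key-injective below
    where
    below : ∀ {p} → Adj G p u → key u < key p
    below {p} adj = combine-monoˡ-< u p
      (subst (_< toℕ (level p)) (cong toℕ (≡-sym (level-S s)))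
             (level-∉S (λ sp → S-independent sp s adj)))

  sink : ∀ {v} → T v → Sink orientation v
  sink {v} t = OrientBy.sink G key key-injective above
    where
    above : ∀ {p} → Adj G v p → key p < key v
    above {p} adj = combine-monoˡ-< p v
      (subst (toℕ (level p) <_) (cong toℕ (≡-sym (level-T t)))
             (level-∉T (λ tp → T-independent t tp adj)))

module CycleVertices {n} {G : Graph n} {k} (C : Cycle G k) where
  open Cycle C using (m; vtx; inj; step)

  index : ℕ → Fin (suc m)
  index i = i mod suc m

  toℕ-index : ∀ {i} → i ≤ m → toℕ (index i) ≡ i
  toℕ-index i≤m = trans (toℕ-fromℕ< _) (m≤n⇒m%n≡m i≤m)

  at : ℕ → Fin n
  at = vtx ∘ index

  at-injective : ∀ {i j} → i ≤ m → j ≤ m → at i ≡ at j → i ≡ j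
  at-injective {i} {j} i≤m j≤m e = begin
    i              ≡⟨ toℕ-index i≤m ⟨
    toℕ (index i)  ≡⟨ cong toℕ (inj e) ⟩
    toℕ (index j)  ≡⟨ toℕ-index j≤m ⟩
    j              ∎
    where open ≡-Reasoning

  at-adjacent : ∀ {i} → i < m → Adj G (at i) (at (suc i))
  at-adjacent {i} i<m =
    subst₂ (λ a b → Adj G (vtx a) (vtx b)) inject₁≡index suc≡index (step (fromℕ< i<m))
    where
    inject₁≡index : inject₁ (fromℕ< i<m) ≡ index i
    inject₁≡index = toℕ-injective (begin
      toℕ (inject₁ (fromℕ< i<m))  ≡⟨ toℕ-inject₁ _ ⟩
      toℕ (fromℕ< i<m)            ≡⟨ toℕ-fromℕ< i<m ⟩
      i                           ≡⟨ toℕ-index (≤-trans (n≤1+n i) i<m) ⟨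
      toℕ (index i)               ∎)
      where open ≡-Reasoning
    suc≡index : Fin.suc (fromℕ< i<m) ≡ index (suc i)
    suc≡index = toℕ-injective (trans (cong suc (toℕ-fromℕ< i<m)) (≡-sym (toℕ-index i<m)))

  chord⇒cycle : ∀ i d → 2 ≤ d → i + d ≤ m → Adj G (at i) (at (i + d)) → Cycle G (suc d)
  chord⇒cycle i d 2≤d i+d≤m chord = record
    { m = d ; len = refl ; atLeast3 = s≤s 2≤d
    ; vtx = vtx′ ; inj = vtx′-injective ; step = step′ ; close = close′ }
    where
    vtx′ : Fin (suc d) → Fin n
    vtx′ f = at (i + toℕ f)

    in-range : ∀ f → i + toℕ f ≤ m
    in-range f = ≤-trans (+-monoʳ-≤ i (toℕ≤pred[n] f)) i+d≤m

    vtx′-injective : Injective _≡_ _≡_ vtx′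
    vtx′-injective {f} {f′} e =
      toℕ-injective (+-cancelˡ-≡ i _ _ (at-injective (in-range f) (in-range f′) e))

    step′ : (f : Fin d) → Adj G (vtx′ (inject₁ f)) (vtx′ (Fin.suc f))
    step′ f rewrite toℕ-inject₁ f | +-suc i (toℕ f) =
      at-adjacent (subst (_≤ m) (+-suc i (toℕ f)) (≤-trans (+-monoʳ-≤ i (toℕ<n f)) i+d≤m))

    close′ : Adj G (vtx′ (fromℕ d)) (vtx′ 0F)
    close′ rewrite toℕ-fromℕ d | +-identityʳ i = Graph.sym G chord

parity : ∀ i → ∃ λ t → i ≡ 2 * t ⊎ i ≡ suc (2 * t)
parity zero = 0 , inj₁ refl
parity (suc i) with parity i
... | t , inj₁ refl = t , inj₂ refl
... | t , inj₂ refl = suc t , inj₁ (≡-sym (*-suc 2 t))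

parity-split : ∀ {P : ℕ → Set} {K} → (∀ {t} → t < K → P (2 * t)) →
               (∀ {t} → t < K → P (suc (2 * t))) → ∀ {i} → i < 2 * K → P i
parity-split {K = K} even odd {i} i<2K with parity i
... | t , inj₁ refl = even (*-cancelˡ-< 2 t K i<2K)
... | t , inj₂ refl = odd (*-cancelˡ-< 2 t K (≤-<-trans (n≤1+n _) i<2K))

ImageBelow : ∀ {n} → (ℕ → Fin n) → ℕ → Pred (Fin n) 0ℓ
ImageBelow f K v = ∃ λ t → t < K × f t ≡ v

imageBelow? : ∀ {n} (f : ℕ → Fin n) K → Decidable (ImageBelow f K)
imageBelow? f K v = anyUpTo? (λ t → f t Fin.≟ v) K

imageBelow-independent : ∀ {n} (G : Graph n) (f : ℕ → Fin n) K →
  (∀ {a b} → a < b → b < K → ¬ Adj G (f a) (f b)) → Independent G (ImageBelow f K)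
imageBelow-independent G f K nonadjacent (a , a<K , refl) (b , b<K , refl) adj
  with <-cmp a b
... | tri< a<b _ _ = nonadjacent a<b b<K adj
... | tri≈ _ refl _ = irrefl G adj
... | tri> _ _ b<a = nonadjacent b<a a<K (Graph.sym G adj)

module ShortestCycle {n} (G : Graph n) {g} (C : Cycle G g) (girth≤ : ∀ k → Cycle G k → g ≤ k)
                 (K : ℕ) (2K≤g : 2 * K ≤ g) where
  open CycleVertices C
  open Cycle C using (m; len)

  <2K⇒≤m : ∀ {i} → i < 2 * K → i ≤ m
  <2K⇒≤m {i} i<2K = ≤-pred (subst (suc i ≤_) len (≤-trans i<2K 2K≤g))

  1+2t<2K : ∀ {t} → t < K → suc (2 * t) < 2 * K
  1+2t<2K {t} t<K = subst (_≤ 2 * K) (*-suc 2 t) (*-monoʳ-≤ 2 t<K)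

  -- The chord closes an odd cycle of length 2o + 3 ≤ 2K - 1 < g.
  even-gap-nonadjacent : ∀ i o → i + 2 * suc o < 2 * K → ¬ Adj G (at i) (at (i + 2 * suc o))
  even-gap-nonadjacent i o bound chord =
    <⇒≱ shorter (girth≤ _ (chord⇒cycle i (2 * suc o) (*-monoʳ-≤ 2 (s≤s z≤n))
                                        (<2K⇒≤m bound) chord))
    where
    shorter : suc (2 * suc o) < g
    shorter = <-≤-trans (1+2t<2K (*-cancelˡ-< 2 (suc o) K (≤-<-trans (m≤n+m _ i) bound))) 2K≤g

  double-gap : ∀ {a b} → a < b → ∃ λ o → 2 * b ≡ 2 * a + 2 * suc o
  double-gap {a} a<b with o , refl ← m≤n⇒∃[o]m+o≡n a<b = o , (begin
    2 * suc (a + o)    ≡⟨ cong (2 *_) (+-suc a o) ⟨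
    2 * (a + suc o)    ≡⟨ *-distribˡ-+ 2 a (suc o) ⟩
    2 * a + 2 * suc o  ∎)
    where open ≡-Reasoning

  evens odds : ℕ → Fin n
  evens t = at (2 * t)
  odds  t = at (suc (2 * t))

  evens-independent : Independent G (ImageBelow evens K)
  evens-independent = imageBelow-independent G evens K nonadjacent
    where
    nonadjacent : ∀ {a b} → a < b → b < K → ¬ Adj G (evens a) (evens b)
    nonadjacent {a} {b} a<b b<K with o , e ← double-gap a<b rewrite e =
      even-gap-nonadjacent (2 * a) o (subst (_< 2 * K) e (*-monoʳ-< 2 b<K))

  odds-independent : Independent G (ImageBelow odds K)
  odds-independent = imageBelow-independent G odds K nonadjacent
    where
    nonadjacent : ∀ {a b} → a < b → b < K → ¬ Adj G (odds a) (odds b)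
    nonadjacent {a} {b} a<b b<K with o , e ← double-gap a<b rewrite e =
      even-gap-nonadjacent (suc (2 * a)) o (subst (_< 2 * K) (cong suc e) (1+2t<2K b<K))

  evens∩odds≡∅ : ∀ {v} → ImageBelow evens K v → ¬ ImageBelow odds K v
  evens∩odds≡∅ (a , a<K , refl) (b , b<K , e) =
    even≢odd a b (≡-sym (at-injective (<2K⇒≤m (1+2t<2K b<K)) (<2K⇒≤m (*-monoʳ-< 2 a<K)) e))

  open Layered G (imageBelow? evens K) (imageBelow? odds K)
               evens-independent odds-independent evens∩odds≡∅

  path⊆MAG : ∀ {M} → IsMAG orientation M → ∀ {i} → i < 2 * K → at i ∈ M
  path⊆MAG {M} mag = parity-split {P = λ i → at i ∈ M}
    (λ {t} t<K → source∈MAG orientation mag (source (t , t<K , refl))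
                   (at-adjacent (<2K⇒≤m (1+2t<2K t<K))))
    (λ {t} t<K → sink∈MAG orientation mag (sink (t , t<K , refl))
                   (at-adjacent (<2K⇒≤m (1+2t<2K t<K))))

  mag≥2K : MagAtLeast orientation (2 * K)
  mag≥2K M mag = injection⇒≤∣p∣ (at ∘ toℕ)
    (λ e → toℕ-injective (at-injective (<2K⇒≤m (toℕ<n _)) (<2K⇒≤m (toℕ<n _)) e))
    (λ i → path⊆MAG mag (toℕ<n i))

  mag⁺≥2K : MagPlusAtLeast G (2 * K)
  mag⁺≥2K = orientation , mag≥2K

corollary4 : (n : ℕ) (G : Graph n) → Connected G → (g : ℕ) → Girth G g → 3 ≤ g →
    (Odd g → MagPlusAtLeast G (g ∸ 1)) × (Even g → MagPlusAtLeast G g)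
corollary4 n G _ g (C , girth≤) _ = odd , even
  where
  odd : Odd g → MagPlusAtLeast G (g ∸ 1)
  odd (k , refl) = ShortestCycle.mag⁺≥2K G C girth≤ k (n≤1+n _)
  even : Even g → MagPlusAtLeast G g
  even (k , refl) = ShortestCycle.mag⁺≥2K G C girth≤ k ≤-refl
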